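{- Let $t\ge 3$, let $G$ be a simple undirected graph in which every vertex has degree at most $t+1$, and let $w$ be a real weight function on the edges of $G$. Any two different problematic forbidden subgraphs of $G$ are vertex-disjoint.
   Context: The forbidden subgraphs of $G$ are its $K_{t+1}$'s and $K_{t,t}$'s, i.e. subgraphs (not necessarily induced) isomorphic to the complete graph on $t+1$ vertices or to the complete bipartite graph with classes of size $t$. $w(H)$ is the total weight of the edges of $H$. A $K_{t+1}$ $H$ of $G$ is unproblematic if it shares a vertex with another forbidden subgraph $H'$ of $G$ such that either $H'$ is a $K_{t+1}$ with $w(H)\le w(H')$, or $H'$ is a $K_{t,t}$; otherwise it is problematic. A $K_{t,t}$ $H$ of $G$ is unproblematic if it shares a vertex with another $K_{t,t}$ $H'$ of $G$ with $w(H)\le w(H')$; otherwise it is problematic. -}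

module Defs where

open import Level using (Level; suc; _⊔_)
open import Data.Nat as ℕ using (ℕ; zero) renaming (suc to sucℕ)
open import Data.Bool using (Bool; true; false; if_then_else_)
open import Data.Fin as Fin using (Fin; toℕ)
open import Data.Fin.Properties using () renaming (_<?_ to _<ᶠ?_)
open import Data.List using (List; map; foldr; filter; cartesianProduct; allFin)
open import Data.Product using (Σ; _×_; _,_; proj₁; proj₂; ∃)
open import Data.Sum using (_⊎_)
open import Data.Unit using (⊤)
open import Data.Empty using (⊥)
open import Relation.Nullary using (¬_)
open import Relation.Binary.PropositionalEquality using (_≡_; _≢_)

-- The paper uses real weights; only the additive monoid
-- structure and a compatible total order are relevant, so we take an
-- arbitrary linearly ordered commutative monoid (ℝ with + and ≤ is one).

record OrderedWeights : Set₁ where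
  infixl 6 _+_
  infix 4 _≤_
  field
    W        : Set
    0#       : W
    _+_      : W → W → W
    _≤_      : W → W → Set
    +-assoc  : ∀ x y z → (x + y) + z ≡ x + (y + z)
    +-comm   : ∀ x y → x + y ≡ y + x
    +-idˡ    : ∀ x → 0# + x ≡ x
    ≤-refl   : ∀ x → x ≤ x
    ≤-trans  : ∀ {x y z} → x ≤ y → y ≤ z → x ≤ z
    ≤-antisym : ∀ {x y} → x ≤ y → y ≤ x → x ≡ y
    ≤-total  : ∀ x y → x ≤ y ⊎ y ≤ x
    +-mono-≤ : ∀ {x y} z → x ≤ y → x + z ≤ y + z

record Graph : Set where
  field
    n      : ℕ
    adj    : Fin n → Fin n → Bool
    sym    : ∀ u v → adj u v ≡ adj v u
    irrefl : ∀ v → adj v v ≡ false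

module _ (G : Graph) where
  open Graph G

  degree : Fin n → ℕ
  degree v = foldr ℕ._+_ 0 (map (λ u → if adj v u then 1 else 0) (allFin n))

  -- A subgraph isomorphic to K_{t+1}, given by an injective labelling
  -- of its vertices.
  record Clique (t : ℕ) : Set where
    field
      f     : Fin (sucℕ t) → Fin n
      inj   : ∀ i j → f i ≡ f j → i ≡ j
      edge  : ∀ i j → i ≢ j → adj (f i) (f j) ≡ true

  record Biclique (t : ℕ) : Set where
    field
      g     : Fin t → Fin n
      h     : Fin t → Fin n
      g-inj : ∀ i j → g i ≡ g j → i ≡ j
      h-inj : ∀ i j → h i ≡ h j → i ≡ j
      disj  : ∀ i j → g i ≢ h j
      edge  : ∀ i j → adj (g i) (h j) ≡ true

  data Forb (t : ℕ) : Set where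
    kclique : Clique t → Forb t
    kbip    : Biclique t → Forb t

  module _ {t : ℕ} where

    HasV : Forb t → Fin n → Set
    HasV (kclique K) v = ∃ λ i → Clique.f K i ≡ v
    HasV (kbip B)    v = (∃ λ i → Biclique.g B i ≡ v) ⊎ (∃ λ i → Biclique.h B i ≡ v)

    HasE : Forb t → Fin n → Fin n → Set
    HasE (kclique K) u v =
      ∃ λ i → ∃ λ j → i ≢ j × Clique.f K i ≡ u × Clique.f K j ≡ v
    HasE (kbip B) u v = ∃ λ i → ∃ λ j →
      (Biclique.g B i ≡ u × Biclique.h B j ≡ v) ⊎ (Biclique.g B i ≡ v × Biclique.h B j ≡ u)

    SameSubgraph : Forb t → Forb t → Set
    SameSubgraph H H' =
      (∀ v → (HasV H v → HasV H' v) × (HasV H' v → HasV H v)) ×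
      (∀ u v → (HasE H u v → HasE H' u v) × (HasE H' u v → HasE H u v))

    ShareVertex : Forb t → Forb t → Set
    ShareVertex H H' = ∃ λ v → HasV H v × HasV H' v

  module _ (O : OrderedWeights) (w : Fin n → Fin n → OrderedWeights.W O) {t : ℕ} where
    open OrderedWeights O

    sumW : List W → W
    sumW = foldr _+_ 0#

    weight : Forb t → W
    weight (kclique K) =
      sumW (map (λ p → w (Clique.f K (proj₁ p)) (Clique.f K (proj₂ p)))
                (filter (λ p → proj₁ p <ᶠ? proj₂ p)
                        (cartesianProduct (allFin (sucℕ t)) (allFin (sucℕ t)))))
    weight (kbip B) =
      sumW (map (λ p → w (Biclique.g B (proj₁ p)) (Biclique.h B (proj₂ p)))
                (cartesianProduct (allFin t) (allFin t)))

    -- the condition H' must satisfy (besides being another forbidden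
    -- subgraph sharing a vertex with H) to make H unproblematic
    Beats : Forb t → Forb t → Set
    Beats (kclique K) (kclique K') = weight (kclique K) ≤ weight (kclique K')
    Beats (kclique K) (kbip B')    = ⊤
    Beats (kbip B)    (kclique K') = ⊥
    Beats (kbip B)    (kbip B')    = weight (kbip B) ≤ weight (kbip B')

    Unproblematic : Forb t → Set
    Unproblematic H =
      Σ (Forb t) λ H' → ¬ SameSubgraph H H' × ShareVertex H H' × Beats H H'

    Problematic : Forb t → Set
    Problematic H = ¬ Unproblematic H

-- Among two distinct forbidden subgraphs sharing a vertex, one always makes
-- the other unproblematic: a K_{t,t} beats every K_{t+1}, and two subgraphs
-- of the same kind are ordered by weight, since the order is total.
module Submission where

open import Defs
open import Data.Nat using (ℕ; _≤_; suc)
open import Data.Fin using (Fin)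
open import Data.Product using (_,_; swap)
open import Data.Sum using (_⊎_; inj₁; inj₂)
open import Data.Unit using (tt)
open import Relation.Nullary using (¬_)
open import Relation.Binary.PropositionalEquality using (_≡_)

module _ (G : Graph) {t : ℕ} where

  SameSubgraph-sym : {H H' : Forb G t} → SameSubgraph G H H' → SameSubgraph G H' H
  SameSubgraph-sym (sameV , sameE) = (λ v → swap (sameV v)) , (λ u v → swap (sameE u v))

  ShareVertex-sym : {H H' : Forb G t} → ShareVertex G H H' → ShareVertex G H' H
  ShareVertex-sym (v , inH , inH') = v , inH' , inH

  module _ (O : OrderedWeights) (w : Fin (Graph.n G) → Fin (Graph.n G) → OrderedWeights.W O) where
    open OrderedWeights O using (≤-total)

    Beats-total : (H H' : Forb G t) → Beats G O w H H' ⊎ Beats G O w H' H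
    Beats-total (kclique K) (kclique K') = ≤-total _ _
    Beats-total (kclique K) (kbip B')    = inj₁ tt
    Beats-total (kbip B)    (kclique K') = inj₂ tt
    Beats-total (kbip B)    (kbip B')    = ≤-total _ _

    problematic-disjoint : (H H' : Forb G t) →
      Problematic G O w H → Problematic G O w H' →
      ¬ SameSubgraph G H H' → ¬ ShareVertex G H H'
    problematic-disjoint H H' pH pH' H≉H' share with Beats-total H H'
    ... | inj₁ H'-beats-H = pH (H' , H≉H' , share , H'-beats-H)
    ... | inj₂ H-beats-H' =
      pH' (H , (λ same → H≉H' (SameSubgraph-sym same)) , ShareVertex-sym share , H-beats-H')

lemma4 : (t : ℕ) → 3 ≤ t → (G : Graph) →
    (∀ v → degree G v ≤ suc t) →
    (O : OrderedWeights) →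
    (w : Fin (Graph.n G) → Fin (Graph.n G) → OrderedWeights.W O) →
    (∀ u v → w u v ≡ w v u) →
    (H H' : Forb G t) →
    Problematic G O w H → Problematic G O w H' →
    ¬ SameSubgraph G H H' →
    ¬ ShareVertex G H H'
lemma4 t _ G _ O w _ = problematic-disjoint G O w
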